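{- Let $z\in\mathfrak F_\infty$ and $w^1w^2\cdots w^m\in\mathrm{RF}^m_{\mathsf{FPF}}(z)$. If $\tilde f_i^F(w^1w^2\cdots w^m)\ne\mathbf0$ for some $i\in\{1,\dots,m-1\}$, then $\tilde f_i^F(w^1w^2\cdots w^m)\in\mathrm{RF}^m_{\mathsf{FPF}}(z)$.
   Context: Let $s_i$ be the simple transposition $(i\ i{+}1)$, $\mathfrak S_\infty$ the finitely supported permutations of $\{1,2,\dots\}$, $\Theta=(1\,2)(3\,4)\cdots$, $\mathfrak F_\infty=\{\pi^{ -1}\Theta\pi:\pi\in\mathfrak S_\infty\}$. For $z\in\mathfrak F_\infty$, $\hat{\mathcal R}_{\mathsf{FPF}}(z)$ is the set of FPF-involution words for $z$: words $i_1\cdots i_l$ of positive integers with $z=s_{i_l}\cdots s_{i_1}\Theta s_{i_1}\cdots s_{i_l}$ and $l$ minimal. An increasing factorization with $m$ blocks of $w$ is a sequence $w^1\cdots w^m$ of strictly increasing (possibly empty) words concatenating to $w$; $\mathrm{RF}^m_{\mathsf{FPF}}(z)$ is the set of these for all $w\in\hat{\mathcal R}_{\mathsf{FPF}}(z)$. $\mathrm{cont}(u)$ is the set of letters of $u$. The Morse–Schilling operator $\tilde f_i^F$ acts on a sequence $w^1\cdots w^m$ of strictly increasing words only through the blocks $w^iw^{i+1}$: pair the largest $b\in\mathrm{cont}(w^{i+1})$ with the smallest $a>b$ in $\mathrm{cont}(w^i)$ (if none, $b$ is unpaired), and proceed in decreasing order through the letters of $w^{i+1}$, ignoring already paired letters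 of $w^i$. Let $L_i$ be the set of unpaired letters of $w^i$. If $L_i=\emptyset$, $\tilde f_i^F(w^1\cdots w^m)=\mathbf0$; otherwise with $c=\max L_i$ and $s=\min\{j\ge0:c+j+1\notin\mathrm{cont}(w^i)\}$, $\tilde f_i^F$ replaces $w^i,w^{i+1}$ by the strictly increasing words with contents $\mathrm{cont}(w^i)\setminus\{c\}$ and $\mathrm{cont}(w^{i+1})\cup\{c+s\}$. -}

module Defs where

open import Data.Nat using (ℕ; zero; suc; _+_; _≤_; _<_; _≟_; _<?_; _⊔_)
open import Data.Bool using (Bool; true; false; if_then_else_; not)
open import Data.List using (List; []; _∷_; reverse; length; concat; filter; map; foldl)
open import Data.List.Relation.Unary.All using (All)
open import Data.List.Relation.Unary.Linked using (Linked)
open import Data.List.Membership.DecPropositional _≟_ using (_∈?_)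
open import Data.Maybe using (Maybe; just; nothing)
open import Relation.Nullary.Decidable using (¬?)
open import Data.Product using (_×_; _,_; ∃)
open import Relation.Nullary using (does)
open import Relation.Binary.PropositionalEquality using (_≡_)

-- Permutations of {1,2,...} are modelled as functions ℕ → ℕ
-- (0 is an extra point fixed by everything below).

s : ℕ → ℕ → ℕ
s i x = if does (x ≟ i) then suc i else (if does (x ≟ suc i) then i else x)

-- Θ = (1 2)(3 4)(5 6)...  (fixes 0)
Θ : ℕ → ℕ
Θ zero = zero
Θ (suc zero) = 2
Θ (suc (suc zero)) = 1
Θ (suc (suc (suc n))) = 2 + Θ (suc n)

-- prod (i₁ ∷ … ∷ iₗ) is the permutation s_{i₁} s_{i₂} ⋯ s_{iₗ}
-- (composition of functions, rightmost applied first)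
prod : List ℕ → ℕ → ℕ
prod [] x = x
prod (i ∷ w) x = s i (prod w x)

conj : List ℕ → ℕ → ℕ
conj w x = prod (reverse w) (Θ (prod w x))

PosWord : List ℕ → Set
PosWord w = All (λ i → 1 ≤ i) w

-- z ∈ 𝔉_∞ : z = π⁻¹ Θ π for some finitely supported permutation π;
-- π is given as a product s_{i₁}⋯s_{iₗ} of simple transpositions
-- (these generate 𝔖_∞), in which case π⁻¹Θπ = conj (i₁⋯iₗ).
InF∞ : (ℕ → ℕ) → Set
InF∞ z = ∃ λ (w : List ℕ) → PosWord w × (∀ x → z x ≡ conj w x)

IsFPFWord : (ℕ → ℕ) → List ℕ → Set
IsFPFWord z w =
  PosWord w × (∀ x → z x ≡ conj w x) ×
  (∀ (v : List ℕ) → PosWord v → (∀ x → z x ≡ conj v x) → length w ≤ length v)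

StrictInc : List ℕ → Set
StrictInc = Linked _<_

InRF : ℕ → (ℕ → ℕ) → List (List ℕ) → Set
InRF m z ws = length ws ≡ m × All StrictInc ws × IsFPFWord z (concat ws)

minAbove : ℕ → List ℕ → Maybe ℕ
minAbove b [] = nothing
minAbove b (a ∷ U) with minAbove b U
... | nothing = if does (b <? a) then just a else nothing
... | just a' = if does (b <? a) then (if does (a <? a') then just a else just a') else just a'

remove : ℕ → List ℕ → List ℕ
remove x = filter (λ y → ¬? (y ≟ x))

-- one pairing step: the letter b of w^{i+1} is paired with the smallest
-- still-unpaired a > b of w^i (if any), which is then no longer available
pairStep : List ℕ → ℕ → List ℕ
pairStep U b with minAbove b U
... | nothing = U
... | just a = remove a U

-- L_i : unpaired letters of u = w^i after processing the letters of
-- v = w^{i+1} in decreasing order (v is strictly increasing, so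
-- reverse v lists its letters in decreasing order)
unpaired : List ℕ → List ℕ → List ℕ
unpaired u v = foldl pairStep u (reverse v)

maxL : List ℕ → Maybe ℕ
maxL [] = nothing
maxL (x ∷ xs) with maxL xs
... | nothing = just x
... | just y = just (x ⊔ y)

-- gap fuel c u = min { j ≥ 0 : c + j + 1 ∉ u }, provided fuel > |u|
gap : ℕ → ℕ → List ℕ → ℕ
gap zero c u = zero
gap (suc fuel) c u = if does (suc c ∈? u) then suc (gap fuel (suc c) u) else zero

insert : ℕ → List ℕ → List ℕ
insert x [] = x ∷ []
insert x (y ∷ ys) =
  if does (x <? y) then x ∷ y ∷ ys
  else (if does (x ≟ y) then y ∷ ys else y ∷ insert x ys)

fStep : List ℕ → List ℕ → Maybe (List ℕ × List ℕ)
fStep u v with maxL (unpaired u v)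
... | nothing = nothing
... | just c = just (remove c u , insert (c + gap (suc (length u)) c u) v)

-- f̃ᵢ^F on w¹⋯wᵐ (i is 1-based: acts on blocks i and i+1); nothing = 𝟎
fF : ℕ → List (List ℕ) → Maybe (List (List ℕ))
fF zero ws = nothing
fF (suc zero) (u ∷ v ∷ rest) with fStep u v
... | nothing = nothing
... | just (u' , v') = just (u' ∷ v' ∷ rest)
fF (suc zero) _ = nothing
fF (suc (suc i)) [] = nothing
fF (suc (suc i)) (u ∷ rest) with fF (suc i) rest
... | nothing = nothing
... | just rest' = just (u ∷ rest')

module Submission where

-- Write the factorization as pre · u · v · post with (u , v) = (wⁱ , wⁱ⁺¹).
-- The operator deletes the largest unpaired letter c of u and inserts
-- k = c + s into v, where c+1, …, k ∈ u and k+1 ∉ u.  The pairing rule forces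
-- v to contain c, …, k-1 but not c-1 (max-unpaired-shape).  For the
-- permutations prod u, prod v (products of simple transpositions) this
-- configuration gives
--   prod u = prod (u ∖ c) ∘ (c k+1)                      (prod-remove-letter)
--   (c k+1) ∘ prod v = prod (v ∪ {k})  if k ∉ v          (swap-absorbed-by-insert)
--   (c k+1) ∘ prod v = prod (v ∖ {k})  if k ∈ v          (swap-cancels-letter)
-- so the product of the two blocks is preserved.  Two adjacent blocks of an
-- FPF-involution word admit no shorter factorization (block-reduced), which
-- excludes k ∈ v; so the new word has the same length and, since conj w only
-- depends on prod w, it is again an FPF-involution word for z (replace-block).

open import Defs
open import Data.Bool using (if_then_else_)
open import Data.Empty using (⊥-elim)
open import Data.Maybe using (Maybe; just; nothing)
open import Data.Nat using (ℕ; zero; suc; _+_; _⊔_; _≤_; _<_; _≟_; _<?_; z≤n; s≤s; z<s)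
open import Data.Nat.Properties
open import Data.Product using (_×_; _,_; proj₁; proj₂)
open import Data.Sum using (_⊎_; inj₁; inj₂)
open import Data.List using (List; []; _∷_; _++_; reverse; length; foldl; concat)
open import Data.List.Properties using (filter-accept; filter-reject; filter-all; unfold-reverse; length-++; concat-++)
open import Data.List.Relation.Unary.Any as Any using (Any; here; there)
import Data.List.Relation.Unary.Any.Properties as Any
open import Data.List.Relation.Unary.All as All using (All; []; _∷_)
import Data.List.Relation.Unary.All.Properties as All
open import Data.List.Relation.Unary.AllPairs as AllPairs using (AllPairs; []; _∷_)
import Data.List.Relation.Unary.AllPairs.Properties as AllPairs
open import Data.List.Relation.Unary.Linked as Linked using ([]; [-]; _∷_)
import Data.List.Relation.Unary.Linked.Properties as Linked
open import Data.List.Membership.Propositional using (_∈_; _∉_)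
open import Data.List.Membership.Propositional.Properties using (∈-filter⁺; ∈-filter⁻)
open import Data.List.Membership.DecPropositional _≟_ using (_∈?_)
open import Relation.Nullary using (does; yes; no; ¬_; Dec; ¬?)
open import Relation.Nullary.Decidable using (dec-true; dec-false)
open import Relation.Binary using (tri<; tri≈; tri>)
open import Relation.Binary.PropositionalEquality

-- The transposition exchanging a and b; by definition s i = swap i (suc i).
swap : ℕ → ℕ → ℕ → ℕ
swap a b x = if does (x ≟ a) then b else (if does (x ≟ b) then a else x)

swap-left : ∀ a b → swap a b a ≡ b
swap-left a b rewrite dec-true (a ≟ a) refl = refl

swap-right : ∀ a b → swap a b b ≡ a
swap-right a b with b ≟ a
... | yes refl = swap-left b b
... | no b≢a rewrite dec-false (b ≟ a) b≢a | dec-true (b ≟ b) refl = refl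

swap-other : ∀ a b x → x ≢ a → x ≢ b → swap a b x ≡ x
swap-other a b x x≢a x≢b rewrite dec-false (x ≟ a) x≢a | dec-false (x ≟ b) x≢b = refl

swap-involutive : ∀ a b x → swap a b (swap a b x) ≡ x
swap-involutive a b x = cases (x ≟ a) (x ≟ b)
  where
  cases : Dec (x ≡ a) → Dec (x ≡ b) → swap a b (swap a b x) ≡ x
  cases (yes refl) _ = trans (cong (swap x b) (swap-left x b)) (swap-right x b)
  cases (no _) (yes refl) = trans (cong (swap a x) (swap-right a x)) (swap-left a x)
  cases (no x≢a) (no x≢b) =
    trans (cong (swap a b) (swap-other a b x x≢a x≢b)) (swap-other a b x x≢a x≢b)

swap-disjoint : ∀ a b c d x → a ≢ c → a ≢ d → b ≢ c → b ≢ d →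
  swap a b (swap c d x) ≡ swap c d (swap a b x)
swap-disjoint a b c d x a≢c a≢d b≢c b≢d = cases (x ≟ a) (x ≟ b) (x ≟ c) (x ≟ d)
  where
  cases : Dec (x ≡ a) → Dec (x ≡ b) → Dec (x ≡ c) → Dec (x ≡ d) →
    swap a b (swap c d x) ≡ swap c d (swap a b x)
  cases (yes refl) _ _ _
    rewrite swap-other c d x a≢c a≢d | swap-left x b | swap-other c d b b≢c b≢d = refl
  cases (no _) (yes refl) _ _
    rewrite swap-other c d x b≢c b≢d | swap-right a x | swap-other c d a a≢c a≢d = refl
  cases (no x≢a) (no x≢b) (yes refl) _
    rewrite swap-left x d | swap-other a b d (≢-sym a≢d) (≢-sym b≢d)
          | swap-other a b x x≢a x≢b | swap-left x d = refl
  cases (no x≢a) (no x≢b) (no _) (yes refl)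
    rewrite swap-right c x | swap-other a b c (≢-sym a≢c) (≢-sym b≢c)
          | swap-other a b x x≢a x≢b | swap-right c x = refl
  cases (no x≢a) (no x≢b) (no x≢c) (no x≢d)
    rewrite swap-other c d x x≢c x≢d | swap-other a b x x≢a x≢b
          | swap-other c d x x≢c x≢d = refl

swap-past-end : ∀ a b d x → a ≢ b → a ≢ d → b ≢ d →
  swap a b (swap b d x) ≡ swap b d (swap a d x)
swap-past-end a b d x a≢b a≢d b≢d = cases (x ≟ a) (x ≟ b) (x ≟ d)
  where
  cases : Dec (x ≡ a) → Dec (x ≡ b) → Dec (x ≡ d) →
    swap a b (swap b d x) ≡ swap b d (swap a d x)
  cases (yes refl) _ _
    rewrite swap-other b d x a≢b a≢d | swap-left x b | swap-left x d | swap-right b d = refl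
  cases (no x≢a) (yes refl) _
    rewrite swap-left x d | swap-other a x d (≢-sym a≢d) (≢-sym b≢d)
          | swap-other a d x x≢a b≢d | swap-left x d = refl
  cases (no _) (no _) (yes refl)
    rewrite swap-right b x | swap-right a b | swap-right a x | swap-other b x a a≢b a≢d = refl
  cases (no x≢a) (no x≢b) (no x≢d)
    rewrite swap-other b d x x≢b x≢d | swap-other a b x x≢a x≢b
          | swap-other a d x x≢a x≢d | swap-other b d x x≢b x≢d = refl

swap-past-start : ∀ a b d x → a ≢ b → a ≢ d → b ≢ d →
  swap a d (swap a b x) ≡ swap a b (swap b d x)
swap-past-start a b d x a≢b a≢d b≢d = cases (x ≟ a) (x ≟ b) (x ≟ d)
  where
  cases : Dec (x ≡ a) → Dec (x ≡ b) → Dec (x ≡ d) →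
    swap a d (swap a b x) ≡ swap a b (swap b d x)
  cases (yes refl) _ _
    rewrite swap-left x b | swap-other x d b (≢-sym a≢b) b≢d
          | swap-other b d x a≢b a≢d | swap-left x b = refl
  cases (no _) (yes refl) _
    rewrite swap-right a x | swap-left a d | swap-left x d | swap-other a x d (≢-sym a≢d) (≢-sym b≢d) = refl
  cases (no _) (no _) (yes refl)
    rewrite swap-other a b x (≢-sym a≢d) (≢-sym b≢d) | swap-right a x | swap-right b x | swap-right a b = refl
  cases (no x≢a) (no x≢b) (no x≢d)
    rewrite swap-other a b x x≢a x≢b | swap-other a d x x≢a x≢d
          | swap-other b d x x≢b x≢d | swap-other a b x x≢a x≢b = refl

head<all : ∀ {a : ℕ} {L} → StrictInc (a ∷ L) → All (a <_) L
head<all inc with Linked.Linked⇒AllPairs <-trans inc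
... | a<L ∷ _ = a<L

head<tail : ∀ {a x : ℕ} {L} → StrictInc (a ∷ L) → x ∈ L → a < x
head<tail inc = All.lookup (head<all inc)

head≤ : ∀ {a x : ℕ} {L} → StrictInc (a ∷ L) → x ∈ a ∷ L → a ≤ x
head≤ inc (here refl) = ≤-refl
head≤ inc (there x∈L) = <⇒≤ (head<tail inc x∈L)

∈-tail : ∀ {a x : ℕ} {L} → x ∈ a ∷ L → x ≢ a → x ∈ L
∈-tail (here x≡a) x≢a = ⊥-elim (x≢a x≡a)
∈-tail (there x∈L) _ = x∈L

cons-inc : ∀ {a : ℕ} {L} → All (a <_) L → StrictInc L → StrictInc (a ∷ L)
cons-inc {L = []} _ _ = [-]
cons-inc {L = _ ∷ _} (a<b ∷ _) inc = a<b ∷ inc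

module _ (x : ℕ) where

  private
    ≢x? : ∀ y → Dec (y ≢ x)
    ≢x? y = ¬? (y ≟ x)

  ∈-remove⁻ : ∀ {y} L → y ∈ remove x L → y ∈ L × y ≢ x
  ∈-remove⁻ L = ∈-filter⁻ ≢x? {xs = L}

  ∈-remove⁺ : ∀ {y L} → y ∈ L → y ≢ x → y ∈ remove x L
  ∈-remove⁺ = ∈-filter⁺ ≢x?

  remove-keeps : ∀ {a} L → a ≢ x → remove x (a ∷ L) ≡ a ∷ remove x L
  remove-keeps L = filter-accept ≢x?

  remove-drops : ∀ L → remove x (x ∷ L) ≡ remove x L
  remove-drops L = filter-reject ≢x? (λ x≢x → x≢x refl)

  remove-absent : ∀ {L} → x ∉ L → remove x L ≡ L
  remove-absent x∉L = filter-all ≢x? (All.tabulate (λ y∈L y≡x → x∉L (subst (_∈ _) y≡x y∈L)))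

  remove-inc : ∀ {L} → StrictInc L → StrictInc (remove x L)
  remove-inc = Linked.filter⁺ ≢x? <-trans

  remove-pos : ∀ {L} → PosWord L → PosWord (remove x L)
  remove-pos = All.filter⁺ ≢x?

  -- In a strictly increasing word x occurs at most once.
  remove-length : ∀ {L} → StrictInc L → x ∈ L → suc (length (remove x L)) ≡ length L
  remove-length {a ∷ L} inc x∈aL with a ≟ x
  ... | yes refl rewrite remove-drops L | remove-absent (λ a∈L → <-irrefl refl (head<tail inc a∈L)) = refl
  ... | no a≢x rewrite remove-keeps L a≢x =
    cong suc (remove-length (Linked.tail inc) (∈-tail x∈aL (≢-sym a≢x)))

insert-below : ∀ {k a} v → k < a → insert k (a ∷ v) ≡ k ∷ a ∷ v
insert-below {k} {a} v k<a rewrite dec-true (k <? a) k<a = refl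

insert-present : ∀ {k} v → insert k (k ∷ v) ≡ k ∷ v
insert-present {k} v rewrite dec-false (k <? k) (<-irrefl refl) | dec-true (k ≟ k) refl = refl

insert-above : ∀ {k a} v → a < k → insert k (a ∷ v) ≡ a ∷ insert k v
insert-above {k} {a} v a<k
  rewrite dec-false (k <? a) (<⇒≯ a<k) | dec-false (k ≟ a) (λ k≡a → <-irrefl (sym k≡a) a<k) = refl

∈-insert⁻ : ∀ k v {x} → x ∈ insert k v → x ≡ k ⊎ x ∈ v
∈-insert⁻ k [] (here x≡k) = inj₁ x≡k
∈-insert⁻ k (a ∷ v) x∈ with <-cmp k a
... | tri< k<a _ _ rewrite insert-below v k<a with x∈
...   | here x≡k = inj₁ x≡k
...   | there x∈av = inj₂ x∈av
∈-insert⁻ k (a ∷ v) x∈ | tri≈ _ refl _ rewrite insert-present {k} v = inj₂ x∈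
∈-insert⁻ k (a ∷ v) x∈ | tri> _ _ a<k rewrite insert-above v a<k with x∈
...   | here x≡a = inj₂ (here x≡a)
...   | there x∈kv with ∈-insert⁻ k v x∈kv
...     | inj₁ x≡k = inj₁ x≡k
...     | inj₂ x∈v = inj₂ (there x∈v)

insert-inc : ∀ k {v} → StrictInc v → StrictInc (insert k v)
insert-inc k {[]} _ = [-]
insert-inc k {a ∷ v} inc with <-cmp k a
... | tri< k<a _ _ rewrite insert-below v k<a = k<a ∷ inc
... | tri≈ _ refl _ rewrite insert-present {k} v = inc
... | tri> _ _ a<k rewrite insert-above v a<k =
  cons-inc (All.tabulate (λ x∈ → above (∈-insert⁻ k v x∈))) (insert-inc k (Linked.tail inc))
  where
  above : ∀ {x} → x ≡ k ⊎ x ∈ v → a < x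
  above (inj₁ refl) = a<k
  above (inj₂ x∈v) = head<tail inc x∈v

insert-length : ∀ k {v} → k ∉ v → length (insert k v) ≡ suc (length v)
insert-length k {[]} _ = refl
insert-length k {a ∷ v} k∉av with <-cmp k a
... | tri< k<a _ _ rewrite insert-below v k<a = refl
... | tri≈ _ refl _ = ⊥-elim (k∉av (here refl))
... | tri> _ _ a<k rewrite insert-above v a<k = cong suc (insert-length k (λ k∈v → k∉av (there k∈v)))

prod-++ : ∀ u v x → prod (u ++ v) x ≡ prod u (prod v x)
prod-++ [] v x = refl
prod-++ (i ∷ u) v x = cong (s i) (prod-++ u v x)

-- Every s i is an involution, so prod (reverse w) is the inverse of prod w.
prod-reverse-left : ∀ w x → prod (reverse w) (prod w x) ≡ x
prod-reverse-left [] x = refl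
prod-reverse-left (i ∷ w) x = begin
  prod (reverse (i ∷ w)) (s i (prod w x))   ≡⟨ cong (λ r → prod r (s i (prod w x))) (unfold-reverse i w) ⟩
  prod (reverse w ++ i ∷ []) (s i (prod w x)) ≡⟨ prod-++ (reverse w) (i ∷ []) _ ⟩
  prod (reverse w) (s i (s i (prod w x)))   ≡⟨ cong (prod (reverse w)) (swap-involutive i (suc i) _) ⟩
  prod (reverse w) (prod w x)               ≡⟨ prod-reverse-left w x ⟩
  x                                         ∎
  where open ≡-Reasoning

prod-reverse-right : ∀ w x → prod w (prod (reverse w) x) ≡ x
prod-reverse-right [] x = refl
prod-reverse-right (i ∷ w) x = begin
  s i (prod w (prod (reverse (i ∷ w)) x))     ≡⟨ cong (λ r → s i (prod w (prod r x))) (unfold-reverse i w) ⟩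
  s i (prod w (prod (reverse w ++ i ∷ []) x)) ≡⟨ cong (λ y → s i (prod w y)) (prod-++ (reverse w) (i ∷ []) x) ⟩
  s i (prod w (prod (reverse w) (s i x)))     ≡⟨ cong (s i) (prod-reverse-right w (s i x)) ⟩
  s i (s i x)                                 ≡⟨ swap-involutive i (suc i) x ⟩
  x                                           ∎
  where open ≡-Reasoning

conj-cong : ∀ w w' → (∀ x → prod w x ≡ prod w' x) → ∀ x → conj w x ≡ conj w' x
conj-cong w w' same x = begin
  prod (reverse w) (Θ (prod w x))                                ≡⟨ cong (λ y → prod (reverse w) (Θ y)) (same x) ⟩
  prod (reverse w) (Θ (prod w' x))                               ≡˘⟨ cong (prod (reverse w)) (prod-reverse-right w' _) ⟩
  prod (reverse w) (prod w' (prod (reverse w') (Θ (prod w' x)))) ≡˘⟨ cong (prod (reverse w)) (same _) ⟩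
  prod (reverse w) (prod w (prod (reverse w') (Θ (prod w' x)))) ≡⟨ prod-reverse-left w _ ⟩
  prod (reverse w') (Θ (prod w' x))                              ∎
  where open ≡-Reasoning

Covers : List ℕ → ℕ → ℕ → Set
Covers L lo hi = ∀ j → lo ≤ j → j < hi → j ∈ L

covers-from : ∀ {L lo lo' hi} → lo ≤ lo' → Covers L lo hi → Covers L lo' hi
covers-from lo≤lo' cover j lo'≤j = cover j (≤-trans lo≤lo' lo'≤j)

covers-tail : ∀ {a L lo hi} → a < lo → Covers (a ∷ L) lo hi → Covers L lo hi
covers-tail a<lo cover j lo≤j j<hi =
  ∈-tail (cover j lo≤j j<hi) (λ j≡a → <-irrefl (sym j≡a) (<-≤-trans a<lo lo≤j))

NoPredecessorIn : List ℕ → ℕ → Set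
NoPredecessorIn v c = ∀ {b} → b ∈ v → suc b ≢ c

swap-commutes-above : ∀ c d L → c < d → All (d <_) L →
  ∀ y → swap c d (prod L y) ≡ prod L (swap c d y)
swap-commutes-above c d [] c<d _ y = refl
swap-commutes-above c d (a ∷ L) c<d (d<a ∷ above) y =
  trans (swap-disjoint c d a (suc a) (prod L y) (<⇒≢ c<a) (<⇒≢ (m<n⇒m<1+n c<a))
                                               (<⇒≢ d<a) (<⇒≢ (m<n⇒m<1+n d<a)))
        (cong (s a) (swap-commutes-above c d L c<d above y))
  where
  c<a : c < a
  c<a = <-trans c<d d<a

swap-slides-along-run : ∀ c e d L → StrictInc L → All (e ≤_) L → Covers L e d → d ∉ L →
  c < e → e ≤ d → ∀ y → swap c e (prod L y) ≡ prod L (swap c d y)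
swap-slides-along-run c e d L inc e≤L run d∉L c<e e≤d y with m≤n⇒m<n∨m≡n e≤d
... | inj₂ refl = swap-commutes-above c e L c<e e<L y
  where
  e<L : All (e <_) L
  e<L = All.tabulate (λ {x} x∈L → ≤∧≢⇒< (All.lookup e≤L x∈L) (λ e≡x → d∉L (subst (_∈ L) (sym e≡x) x∈L)))
swap-slides-along-run c e d [] inc e≤L run d∉L c<e e≤d y | inj₁ e<d with run e ≤-refl e<d
... | ()
swap-slides-along-run c e d (a ∷ L) inc (e≤a ∷ _) run d∉L c<e e≤d y | inj₁ e<d
  with ≤-antisym (head≤ inc (run e ≤-refl e<d)) e≤a
... | refl =
  trans (swap-past-end c a (suc a) (prod L y) (<⇒≢ c<e) (<⇒≢ c<sa) (<⇒≢ (n<1+n a)))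
        (cong (s a) (swap-slides-along-run c (suc a) d L (Linked.tail inc) (head<all inc)
                       (covers-tail (n<1+n a) (covers-from (n≤1+n a) run)) (λ d∈L → d∉L (there d∈L))
                       c<sa e<d y))
  where
  c<sa : c < suc a
  c<sa = m<n⇒m<1+n c<e

prod-remove-letter : ∀ c d u → StrictInc u → c ∈ u → Covers u (suc c) d → d ∉ u → c < d →
  ∀ x → prod u x ≡ prod (remove c u) (swap c d x)
prod-remove-letter c d (a ∷ u) inc c∈au run d∉au c<d x with <-cmp a c
... | tri< a<c _ _ rewrite remove-keeps c u (<⇒≢ a<c) =
  cong (s a) (prod-remove-letter c d u (Linked.tail inc) (∈-tail c∈au (≢-sym (<⇒≢ a<c)))
                (covers-tail (m<n⇒m<1+n a<c) run) (λ d∈u → d∉au (there d∈u)) c<d x)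
... | tri> _ _ c<a = ⊥-elim (<⇒≱ c<a (head≤ inc c∈au))
... | tri≈ _ refl _ rewrite remove-drops a u | remove-absent a (λ a∈u → <-irrefl refl (head<tail inc a∈u)) =
  swap-slides-along-run a (suc a) d u (Linked.tail inc) (head<all inc)
    (covers-tail (n<1+n a) run) (λ d∈u → d∉au (there d∈u)) (n<1+n a) c<d x

swap-passes-below : ∀ {a c k} y → suc a < c → c ≤ k → swap c (suc k) (s a y) ≡ s a (swap c (suc k) y)
swap-passes-below {a} {c} {k} y sa<c c≤k =
  swap-disjoint c (suc k) a (suc a) y (≢-sym (<⇒≢ a<c)) (≢-sym (<⇒≢ sa<c))
    (≢-sym (<⇒≢ (m<n⇒m<1+n a<k))) (≢-sym (<⇒≢ (s≤s a<k)))
  where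
  a<c : a < c
  a<c = <-trans (n<1+n a) sa<c
  a<k : a < k
  a<k = <-≤-trans a<c c≤k

swap-passes-start : ∀ {a k} y → a < k → swap a (suc k) (s a y) ≡ s a (swap (suc a) (suc k) y)
swap-passes-start {a} {k} y a<k =
  swap-past-start a (suc a) (suc k) y (<⇒≢ (n<1+n a)) (<⇒≢ (m<n⇒m<1+n a<k)) (<⇒≢ (s≤s a<k))

swap-absorbed-by-insert : ∀ c k v → StrictInc v → c ≤ k → Covers v c k → k ∉ v → NoPredecessorIn v c →
  ∀ x → swap c (suc k) (prod v x) ≡ prod (insert k v) x
swap-absorbed-by-insert c k [] inc c≤k run k∉v no-pred x with m≤n⇒m<n∨m≡n c≤k
... | inj₁ c<k with run c ≤-refl c<k
...   | ()
swap-absorbed-by-insert c k [] inc c≤k run k∉v no-pred x | inj₂ refl = refl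
swap-absorbed-by-insert c k (a ∷ v) inc c≤k run k∉av no-pred x with <-cmp k a
... | tri≈ _ refl _ = ⊥-elim (k∉av (here refl))
... | tri< k<a _ _ rewrite insert-below v k<a with m≤n⇒m<n∨m≡n c≤k
...   | inj₂ refl = refl
...   | inj₁ c<k = ⊥-elim (<⇒≱ (<-trans c<k k<a) (head≤ inc (run c ≤-refl c<k)))
swap-absorbed-by-insert c k (a ∷ v) inc c≤k run k∉av no-pred x | tri> _ _ a<k
  rewrite insert-above v a<k with <-cmp (suc a) c
... | tri≈ _ sa≡c _ = ⊥-elim (no-pred (here refl) sa≡c)
... | tri< sa<c _ _ =
  trans (swap-passes-below (prod v x) sa<c c≤k)
        (cong (s a) (swap-absorbed-by-insert c k v (Linked.tail inc) c≤k
                       (covers-tail (<-trans (n<1+n a) sa<c) run) (λ k∈v → k∉av (there k∈v))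
                       (λ b∈v → no-pred (there b∈v)) x))
... | tri> _ _ c<sa with ≤-antisym (head≤ inc (run c ≤-refl (≤-<-trans (≤-pred c<sa) a<k))) (≤-pred c<sa)
...   | refl =
  trans (swap-passes-start (prod v x) a<k)
        (cong (s a) (swap-absorbed-by-insert (suc a) k v (Linked.tail inc) a<k
                       (covers-tail (n<1+n a) (covers-from (n≤1+n a) run)) (λ k∈v → k∉av (there k∈v))
                       (λ b∈v sb≡sa → <-irrefl (sym (suc-injective sb≡sa)) (head<tail inc b∈v)) x))

swap-cancels-letter : ∀ c k v → StrictInc v → c ≤ k → Covers v c k → k ∈ v → NoPredecessorIn v c →
  ∀ x → swap c (suc k) (prod v x) ≡ prod (remove k v) x
swap-cancels-letter c k (a ∷ v) inc c≤k run k∈av no-pred x with <-cmp (suc a) c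
... | tri≈ _ sa≡c _ = ⊥-elim (no-pred (here refl) sa≡c)
... | tri< sa<c _ _ rewrite remove-keeps k v (<⇒≢ (<-≤-trans (<-trans (n<1+n a) sa<c) c≤k)) =
  trans (swap-passes-below (prod v x) sa<c c≤k)
        (cong (s a) (swap-cancels-letter c k v (Linked.tail inc) c≤k
                       (covers-tail (<-trans (n<1+n a) sa<c) run) (∈-tail k∈av (≢-sym (<⇒≢ a<k)))
                       (λ b∈v → no-pred (there b∈v)) x))
  where
  a<k : a < k
  a<k = <-≤-trans (<-trans (n<1+n a) sa<c) c≤k
... | tri> _ _ c<sa with m≤n⇒m<n∨m≡n c≤k
...   | inj₁ c<k with ≤-antisym (head≤ inc (run c ≤-refl c<k)) (≤-pred c<sa)
...     | refl rewrite remove-keeps k v (<⇒≢ c<k) =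
  trans (swap-passes-start (prod v x) c<k)
        (cong (s a) (swap-cancels-letter (suc a) k v (Linked.tail inc) c<k
                       (covers-tail (n<1+n a) (covers-from (n≤1+n a) run)) (∈-tail k∈av (≢-sym (<⇒≢ c<k)))
                       (λ b∈v sb≡sa → <-irrefl (sym (suc-injective sb≡sa)) (head<tail inc b∈v)) x))
swap-cancels-letter c k (a ∷ v) inc c≤k run k∈av no-pred x | tri> _ _ c<sa | inj₂ refl
  with ≤-antisym (head≤ inc k∈av) (≤-pred c<sa)
... | refl rewrite remove-drops a v | remove-absent a (λ a∈v → <-irrefl refl (head<tail inc a∈v)) =
  swap-involutive a (suc a) (prod v x)

MinAboveSpec : ℕ → List ℕ → Maybe ℕ → Set
MinAboveSpec b U nothing = ∀ {x} → x ∈ U → ¬ b < x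
MinAboveSpec b U (just a) = a ∈ U × b < a × (∀ {x} → x ∈ U → b < x → a ≤ x)

minAbove-spec : ∀ b U → MinAboveSpec b U (minAbove b U)
minAbove-spec b [] = λ ()
minAbove-spec b (a ∷ U) with minAbove b U | minAbove-spec b U
... | nothing | none-in-U = first (b <? a)
  where
  first : (b<a? : Dec (b < a)) → MinAboveSpec b (a ∷ U) (if does b<a? then just a else nothing)
  first (yes b<a) = here refl , b<a , λ { (here refl) _ → ≤-refl ; (there x∈U) b<x → ⊥-elim (none-in-U x∈U b<x) }
  first (no b≮a) = λ { (here refl) → b≮a ; (there x∈U) → none-in-U x∈U }
... | just m | (m∈U , b<m , m-min) = better (b <? a)
  where
  better : (b<a? : Dec (b < a)) →
    MinAboveSpec b (a ∷ U) (if does b<a? then (if does (a <? m) then just a else just m) else just m)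
  better (no b≮a) = there m∈U , b<m , λ { (here refl) b<x → ⊥-elim (b≮a b<x) ; (there x∈U) b<x → m-min x∈U b<x }
  better (yes b<a) = smaller (a <? m)
    where
    smaller : (a<m? : Dec (a < m)) → MinAboveSpec b (a ∷ U) (if does a<m? then just a else just m)
    smaller (yes a<m) = here refl , b<a , λ { (here refl) _ → ≤-refl ; (there x∈U) b<x → <⇒≤ (<-≤-trans a<m (m-min x∈U b<x)) }
    smaller (no a≮m) = there m∈U , b<m , λ { (here refl) _ → ≮⇒≥ a≮m ; (there x∈U) b<x → m-min x∈U b<x }

minAbove-succ : ∀ b U → suc b ∈ U → minAbove b U ≡ just (suc b)
minAbove-succ b U sb∈U with minAbove b U | minAbove-spec b U
... | nothing | none = ⊥-elim (none sb∈U (n<1+n b))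
... | just a | (_ , b<a , a-min) = cong just (≤-antisym (a-min sb∈U (n<1+n b)) b<a)

pairStep-⊆ : ∀ U b {x} → x ∈ pairStep U b → x ∈ U
pairStep-⊆ U b x∈ with minAbove b U
... | nothing = x∈
... | just a = proj₁ (∈-remove⁻ a U x∈)

pairStep-removes : ∀ U b {a} → minAbove b U ≡ just a → a ∉ pairStep U b
pairStep-removes U b {a} eq rewrite eq = λ a∈ → proj₂ (∈-remove⁻ a U a∈) refl

pairStep-partner : ∀ U b {x} → x ∈ U → x ∉ pairStep U b → minAbove b U ≡ just x
pairStep-partner U b {x} x∈U x∉ with minAbove b U
... | nothing = ⊥-elim (x∉ x∈U)
... | just a with x ≟ a
...   | yes refl = refl
...   | no x≢a = ⊥-elim (x∉ (∈-remove⁺ a x∈U x≢a))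

survivors : List ℕ → List ℕ → List ℕ
survivors U bs = foldl pairStep U bs

survivors-⊆ : ∀ U bs {x} → x ∈ survivors U bs → x ∈ U
survivors-⊆ U [] x∈ = x∈
survivors-⊆ U (b ∷ bs) x∈ = pairStep-⊆ U b (survivors-⊆ (pairStep U b) bs x∈)

-- If b is among the pairing letters, then b + 1 does not survive: it is
-- either paired with b or was paired before.
successor-paired : ∀ U bs {b} → b ∈ bs → suc b ∉ survivors U bs
successor-paired U (b' ∷ bs) (there b∈bs) sb∈ = successor-paired (pairStep U b') bs b∈bs sb∈
successor-paired U (b ∷ bs) (here refl) sb∈ =
  pairStep-removes U b (minAbove-succ b U (pairStep-⊆ U b sb∈')) sb∈'
  where
  sb∈' : suc b ∈ pairStep U b
  sb∈' = survivors-⊆ (pairStep U b) bs sb∈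

-- Strictly decreasing words: the order in which the letters of v are paired.
Decreasing : List ℕ → Set
Decreasing = AllPairs (λ x y → y < x)

reverse-decreasing : ∀ {v} → StrictInc v → Decreasing (reverse v)
reverse-decreasing {[]} _ = []
reverse-decreasing {a ∷ v} inc rewrite unfold-reverse a v =
  AllPairs.++⁺ (reverse-decreasing (Linked.tail inc)) ([] ∷ [])
    (All.tabulate (λ x∈ → head<tail inc (Any.reverse⁻ x∈) ∷ []))

paired-by-predecessor : ∀ U bs {y a} → Decreasing bs → y ∈ survivors U bs → a ∈ U → y < a →
  a ∉ survivors U bs → (∀ x → y < x → x < a → x ∈ U ⊎ All (λ b → suc b < x) bs) →
  Any (λ b → suc b ≡ a) bs
paired-by-predecessor U [] _ _ a∈U _ a∉ _ = ⊥-elim (a∉ a∈U)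
paired-by-predecessor U (b ∷ bs) {y} {a} (bs<b ∷ dec) y∈ a∈U y<a a∉ available with a ∈? pairStep U b
... | yes a∈U' = there (paired-by-predecessor (pairStep U b) bs dec y∈ a∈U' y<a a∉ still-available)
  where
  still-available : ∀ x → y < x → x < a → x ∈ pairStep U b ⊎ All (λ b' → suc b' < x) bs
  still-available x y<x x<a with available x y<x x<a
  ... | inj₂ (_ ∷ above-bs) = inj₂ above-bs
  ... | inj₁ x∈U with x ∈? pairStep U b
  ...   | yes x∈U' = inj₁ x∈U'
  ...   | no x∉U' with subst (MinAboveSpec b U) (pairStep-partner U b x∈U x∉U') (minAbove-spec b U)
  ...     | (_ , b<x , _) = inj₂ (All.map (λ b'<b → ≤-<-trans b'<b b<x) bs<b)
... | no a∉U' with suc b ≟ a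
...   | yes sb≡a = here sb≡a
...   | no sb≢a with subst (MinAboveSpec b U) (pairStep-partner U b a∈U a∉U') (minAbove-spec b U)
...     | (_ , b<a , a-least) with b <? y
  -- a is the least letter above b; y < a rules out b < y, and y ≤ b makes
  -- b + 1 < a available, which b would have taken instead of a.
...       | yes b<y = ⊥-elim (<⇒≱ y<a (a-least (pairStep-⊆ U b (survivors-⊆ (pairStep U b) bs y∈)) b<y))
...       | no b≮y with available (suc b) (s≤s (≮⇒≥ b≮y)) (≤∧≢⇒< b<a sb≢a)
...         | inj₁ sb∈U = ⊥-elim (<⇒≱ (≤∧≢⇒< b<a sb≢a) (a-least sb∈U (n<1+n b)))
...         | inj₂ (sb<sb ∷ _) = ⊥-elim (<-irrefl refl sb<sb)

MaxSpec : List ℕ → Maybe ℕ → Set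
MaxSpec L nothing = ∀ {x} → x ∉ L
MaxSpec L (just c) = c ∈ L × (∀ {x} → x ∈ L → x ≤ c)

maxL-spec : ∀ L → MaxSpec L (maxL L)
maxL-spec [] = λ ()
maxL-spec (x ∷ xs) with maxL xs | maxL-spec xs
... | nothing | empty = here refl , λ { (here refl) → ≤-refl ; (there y∈) → ⊥-elim (empty y∈) }
... | just m | (m∈ , m-max) =
  ⊔-member (⊔-sel x m) , λ { (here refl) → m≤m⊔n x m ; (there y∈) → ≤-trans (m-max y∈) (m≤n⊔m x m) }
  where
  ⊔-member : (x ⊔ m ≡ x) ⊎ (x ⊔ m ≡ m) → x ⊔ m ∈ x ∷ xs
  ⊔-member (inj₁ eq) = here eq
  ⊔-member (inj₂ eq) = there (subst (_∈ xs) (sym eq) m∈)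

gap-covers : ∀ f c u → Covers u (suc c) (suc (c + gap f c u))
gap-covers zero c u j c<j j< = ⊥-elim (<⇒≱ c<j (subst (j ≤_) (+-identityʳ c) (≤-pred j<)))
gap-covers (suc f) c u = cases (suc c ∈? u)
  where
  cases : (sc∈? : Dec (suc c ∈ u)) →
    Covers u (suc c) (suc (c + (if does sc∈? then suc (gap f (suc c) u) else zero)))
  cases (yes sc∈u) j c<j j< with m≤n⇒m<n∨m≡n c<j
  ... | inj₂ refl = sc∈u
  ... | inj₁ sc<j = gap-covers f (suc c) u j sc<j (subst (j <_) (cong suc (+-suc c _)) j<)
  cases (no _) j c<j j< = ⊥-elim (<⇒≱ c<j (subst (j ≤_) (+-identityʳ c) (≤-pred j<)))

gap-bounded : ∀ f c u → gap f c u ≤ f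
gap-bounded zero c u = z≤n
gap-bounded (suc f) c u = cases (suc c ∈? u)
  where
  cases : (sc∈? : Dec (suc c ∈ u)) → (if does sc∈? then suc (gap f (suc c) u) else zero) ≤ suc f
  cases (yes _) = s≤s (gap-bounded f (suc c) u)
  cases (no _) = z≤n

gap-stops : ∀ f c u → gap f c u < f → suc (c + gap f c u) ∉ u
gap-stops (suc f) c u = cases (suc c ∈? u)
  where
  cases : (sc∈? : Dec (suc c ∈ u)) → (if does sc∈? then suc (gap f (suc c) u) else zero) < suc f →
    suc (c + (if does sc∈? then suc (gap f (suc c) u) else zero)) ∉ u
  cases (yes _) g<f end∈u =
    gap-stops f (suc c) u (≤-pred g<f) (subst (_∈ u) (cong suc (+-suc c (gap f (suc c) u))) end∈u)
  cases (no sc∉u) _ end∈u = sc∉u (subst (_∈ u) (cong suc (+-identityʳ c)) end∈u)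

covered-length : ∀ lo n u → StrictInc u → Covers u lo (lo + n) → n ≤ length u
covered-length lo zero u inc cover = z≤n
covered-length lo (suc n) [] inc cover with cover lo ≤-refl (m<m+n lo z<s)
... | ()
covered-length lo (suc n) (a ∷ u) inc cover with <-cmp a lo
... | tri< a<lo _ _ = m≤n⇒m≤1+n (covered-length lo (suc n) u (Linked.tail inc) (covers-tail a<lo cover))
... | tri> _ _ lo<a = ⊥-elim (<⇒≱ lo<a (head≤ inc (cover lo ≤-refl (m<m+n lo z<s))))
... | tri≈ _ refl _ = s≤s (covered-length (suc a) n u (Linked.tail inc)
    (covers-tail (n<1+n a) (λ j sa≤j j< → cover j (<⇒≤ sa≤j) (subst (j <_) (sym (+-suc a n)) j<))))

gap-below-fuel : ∀ c u → StrictInc u → gap (suc (length u)) c u < suc (length u)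
gap-below-fuel c u inc with m≤n⇒m<n∨m≡n (gap-bounded (suc (length u)) c u)
... | inj₁ g<f = g<f
... | inj₂ g≡f = ⊥-elim (1+n≰n (covered-length (suc c) (suc (length u)) u inc
    (subst (λ g → Covers u (suc c) (suc (c + g))) g≡f (gap-covers (suc (length u)) c u))))

Reduced : List ℕ → List ℕ → Set
Reduced u v = ∀ u₂ v₂ → PosWord u₂ → PosWord v₂ → (∀ x → prod u (prod v x) ≡ prod u₂ (prod v₂ x)) →
  length u + length v ≤ length u₂ + length v₂

record Exchange (u v u' v' : List ℕ) : Set where
  field
    positive₁ : PosWord u'
    positive₂ : PosWord v'
    same-length : length u' + length v' ≡ length u + length v
    same-product : ∀ x → prod u (prod v x) ≡ prod u' (prod v' x)

record MoveShape (u v : List ℕ) (c k : ℕ) : Set where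
  field
    c∈u : c ∈ u
    c≤k : c ≤ k
    run-u : Covers u (suc c) (suc k)
    end-u : suc k ∉ u
    run-v : Covers v c k
    no-pred : NoPredecessorIn v c

-- The largest unpaired letter c of u, with k = c + s as in the definition of
-- f̃ᵢ, has this shape; v covers c, …, k-1 because every letter j+1 in that
-- range is paired, and only j can be its partner.
max-unpaired-shape : ∀ {u v c} → StrictInc u → StrictInc v → c ∈ unpaired u v →
  (∀ {x} → x ∈ unpaired u v → x ≤ c) → MoveShape u v c (c + gap (suc (length u)) c u)
max-unpaired-shape {u} {v} {c} inc-u inc-v c∈L c-max = record
  { c∈u = survivors-⊆ u (reverse v) c∈L
  ; c≤k = m≤m+n c _
  ; run-u = run-u
  ; end-u = gap-stops (suc (length u)) c u (gap-below-fuel c u inc-u)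
  ; run-v = run-v
  ; no-pred = λ b∈v sb≡c →
      successor-paired u (reverse v) (Any.reverse⁺ b∈v) (subst (_∈ unpaired u v) (sym sb≡c) c∈L)
  }
  where
  k = c + gap (suc (length u)) c u
  run-u : Covers u (suc c) (suc k)
  run-u = gap-covers (suc (length u)) c u
  run-v : Covers v c k
  run-v j c≤j j<k = Any.map (λ sb≡sj → sym (suc-injective sb≡sj)) (Any.reverse⁻
    (paired-by-predecessor u (reverse v) (reverse-decreasing inc-v) c∈L
      (run-u (suc j) (s≤s c≤j) (s≤s j<k)) (s≤s c≤j) (λ sj∈L → <⇒≱ (s≤s c≤j) (c-max sj∈L))
      (λ x c<x x<sj → inj₁ (run-u x c<x (<-trans x<sj (s≤s j<k))))))

move-preserves-product : ∀ {u v c k} → StrictInc u → StrictInc v → MoveShape u v c k → k ∉ v →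
  ∀ x → prod u (prod v x) ≡ prod (remove c u) (prod (insert k v) x)
move-preserves-product {u} {v} {c} {k} inc-u inc-v shape k∉v x =
  trans (prod-remove-letter c (suc k) u inc-u c∈u run-u end-u (s≤s c≤k) (prod v x))
        (cong (prod (remove c u)) (swap-absorbed-by-insert c k v inc-v c≤k run-v k∉v no-pred x))
  where open MoveShape shape

cancel-preserves-product : ∀ {u v c k} → StrictInc u → StrictInc v → MoveShape u v c k → k ∈ v →
  ∀ x → prod u (prod v x) ≡ prod (remove c u) (prod (remove k v) x)
cancel-preserves-product {u} {v} {c} {k} inc-u inc-v shape k∈v x =
  trans (prod-remove-letter c (suc k) u inc-u c∈u run-u end-u (s≤s c≤k) (prod v x))
        (cong (prod (remove c u)) (swap-cancels-letter c k v inc-v c≤k run-v k∈v no-pred x))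
  where open MoveShape shape

-- Hence for a reduced pair k ∉ v (else deleting c and k would shorten the
-- pair), and moving the letter is an exchange of strictly increasing words.
move-letter : ∀ {u v c k} → StrictInc u → StrictInc v → PosWord u → PosWord v → Reduced u v →
  MoveShape u v c k → StrictInc (remove c u) × StrictInc (insert k v) × Exchange u v (remove c u) (insert k v)
move-letter {u} {v} {c} {k} inc-u inc-v pos-u pos-v reduced shape with k ∈? v
... | yes k∈v = ⊥-elim (<⇒≱ shorter (reduced (remove c u) (remove k v) (remove-pos c pos-u) (remove-pos k pos-v)
                                        (cancel-preserves-product inc-u inc-v shape k∈v)))
  where
  open MoveShape shape
  shorter : length (remove c u) + length (remove k v) < length u + length v
  shorter rewrite sym (remove-length c inc-u c∈u) | sym (remove-length k inc-v k∈v) =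
    s≤s (+-monoʳ-≤ (length (remove c u)) (n≤1+n _))
... | no k∉v = remove-inc c inc-u , insert-inc k inc-v , record
  { positive₁ = remove-pos c pos-u
  ; positive₂ = All.tabulate (λ x∈ → positive (∈-insert⁻ k v x∈))
  ; same-length = same-length
  ; same-product = move-preserves-product inc-u inc-v shape k∉v
  }
  where
  open MoveShape shape
  positive : ∀ {x} → x ≡ k ⊎ x ∈ v → 1 ≤ x
  positive (inj₁ refl) = ≤-trans (All.lookup pos-u c∈u) c≤k
  positive (inj₂ x∈v) = All.lookup pos-v x∈v
  same-length : length (remove c u) + length (insert k v) ≡ length u + length v
  same-length = begin
    length (remove c u) + length (insert k v) ≡⟨ cong (length (remove c u) +_) (insert-length k k∉v) ⟩
    length (remove c u) + suc (length v)      ≡⟨ +-suc _ _ ⟩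
    suc (length (remove c u)) + length v      ≡⟨ cong (_+ length v) (remove-length c inc-u c∈u) ⟩
    length u + length v                       ∎
    where open ≡-Reasoning

fStep-exchange : ∀ {u v u' v'} → StrictInc u → StrictInc v → PosWord u → PosWord v → Reduced u v →
  fStep u v ≡ just (u' , v') → StrictInc u' × StrictInc v' × Exchange u v u' v'
fStep-exchange {u} {v} inc-u inc-v pos-u pos-v reduced step
  with maxL (unpaired u v) | maxL-spec (unpaired u v) | step
... | just c | (c∈L , c-max) | refl =
  move-letter inc-u inc-v pos-u pos-v reduced (max-unpaired-shape inc-u inc-v c∈L c-max)

prod-replace-block : ∀ A u v u' v' B → (∀ x → prod u (prod v x) ≡ prod u' (prod v' x)) →
  ∀ x → prod (A ++ u ++ v ++ B) x ≡ prod (A ++ u' ++ v' ++ B) x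
prod-replace-block A u v u' v' B same x = begin
  prod (A ++ u ++ v ++ B) x           ≡⟨ prod-++ A _ x ⟩
  prod A (prod (u ++ v ++ B) x)       ≡⟨ cong (prod A) (prod-++ u _ x) ⟩
  prod A (prod u (prod (v ++ B) x))   ≡⟨ cong (λ y → prod A (prod u y)) (prod-++ v B x) ⟩
  prod A (prod u (prod v (prod B x))) ≡⟨ cong (prod A) (same (prod B x)) ⟩
  prod A (prod u' (prod v' (prod B x))) ≡˘⟨ cong (λ y → prod A (prod u' y)) (prod-++ v' B x) ⟩
  prod A (prod u' (prod (v' ++ B) x)) ≡˘⟨ cong (prod A) (prod-++ u' _ x) ⟩
  prod A (prod (u' ++ v' ++ B) x)     ≡˘⟨ prod-++ A _ x ⟩
  prod (A ++ u' ++ v' ++ B) x         ∎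
  where open ≡-Reasoning

length-block : (A u v B : List ℕ) → length (A ++ u ++ v ++ B) ≡ length A + ((length u + length v) + length B)
length-block A u v B = begin
  length (A ++ u ++ v ++ B)                   ≡⟨ length-++ A {u ++ v ++ B} ⟩
  length A + length (u ++ v ++ B)             ≡⟨ cong (length A +_) (length-++ u {v ++ B}) ⟩
  length A + (length u + length (v ++ B))     ≡⟨ cong (λ n → length A + (length u + n)) (length-++ v {B}) ⟩
  length A + (length u + (length v + length B)) ≡˘⟨ cong (length A +_) (+-assoc (length u) _ _) ⟩
  length A + ((length u + length v) + length B) ∎
  where open ≡-Reasoning

split-block : ∀ {P : ℕ → Set} A u v B → All P (A ++ u ++ v ++ B) → All P A × All P u × All P v × All P B
split-block A u v B all with All.++⁻ A all
... | all-A , all-uvB with All.++⁻ u all-uvB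
...   | all-u , all-vB with All.++⁻ v all-vB
...     | all-v , all-B = all-A , all-u , all-v , all-B

-- Two adjacent blocks of an FPF-involution word form a reduced pair: a
-- shorter factorization would give a shorter FPF-involution word.
block-reduced : ∀ {z} A u v B → IsFPFWord z (A ++ u ++ v ++ B) → Reduced u v
block-reduced A u v B (pos , z≡ , minimal) u₂ v₂ pos-u₂ pos-v₂ same =
  +-cancelʳ-≤ (length B) _ _ (+-cancelˡ-≤ (length A) _ _
    (subst₂ _≤_ (length-block A u v B) (length-block A u₂ v₂ B)
      (minimal (A ++ u₂ ++ v₂ ++ B) pos₂
        (λ x → trans (z≡ x) (conj-cong (A ++ u ++ v ++ B) (A ++ u₂ ++ v₂ ++ B)
                                  (prod-replace-block A u v u₂ v₂ B same) x)))))
  where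
  pos₂ : PosWord (A ++ u₂ ++ v₂ ++ B)
  pos₂ with split-block A u v B pos
  ... | pos-A , _ , _ , pos-B = All.++⁺ pos-A (All.++⁺ pos-u₂ (All.++⁺ pos-v₂ pos-B))

replace-block : ∀ {z} A {u v u' v'} B → IsFPFWord z (A ++ u ++ v ++ B) → Exchange u v u' v' →
  IsFPFWord z (A ++ u' ++ v' ++ B)
replace-block A {u} {v} {u'} {v'} B (pos , z≡ , minimal) exchange =
  pos' , (λ x → trans (z≡ x) (conj-cong (A ++ u ++ v ++ B) (A ++ u' ++ v' ++ B)
                        (prod-replace-block A u v u' v' B same-product) x)) ,
  (λ w pos-w z≡w → subst (_≤ length w) (sym same-total) (minimal w pos-w z≡w))
  where
  open Exchange exchange
  pos' : PosWord (A ++ u' ++ v' ++ B)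
  pos' with split-block A u v B pos
  ... | pos-A , _ , _ , pos-B = All.++⁺ pos-A (All.++⁺ positive₁ (All.++⁺ positive₂ pos-B))
  same-total : length (A ++ u' ++ v' ++ B) ≡ length (A ++ u ++ v ++ B)
  same-total = begin
    length (A ++ u' ++ v' ++ B)                     ≡⟨ length-block A u' v' B ⟩
    length A + ((length u' + length v') + length B) ≡⟨ cong (λ n → length A + (n + length B)) same-length ⟩
    length A + ((length u + length v) + length B)   ≡˘⟨ length-block A u v B ⟩
    length (A ++ u ++ v ++ B)                       ∎
    where open ≡-Reasoning

data ActsLocally (ws ws' : List (List ℕ)) : Set where
  acts-on : ∀ pre u v post u' v' → ws ≡ pre ++ u ∷ v ∷ post → ws' ≡ pre ++ u' ∷ v' ∷ post →
    fStep u v ≡ just (u' , v') → ActsLocally ws ws'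

fF-acts-locally : ∀ i ws ws' → fF i ws ≡ just ws' → ActsLocally ws ws'
fF-acts-locally (suc zero) (u ∷ v ∷ rest) ws' eq with fStep u v in step | eq
... | just (u' , v') | refl = acts-on [] u v rest u' v' refl refl step
fF-acts-locally (suc (suc i)) (u ∷ rest) ws' eq with fF (suc i) rest in step | eq
... | just rest' | refl with fF-acts-locally (suc i) rest rest' step
...   | acts-on pre a b post a' b' refl refl fstep = acts-on (u ∷ pre) a b post a' b' refl refl fstep

concat-blocks : ∀ pre (u v : List ℕ) post → concat (pre ++ u ∷ v ∷ post) ≡ concat pre ++ u ++ v ++ concat post
concat-blocks pre u v post = sym (concat-++ pre (u ∷ v ∷ post))

block-step : ∀ {z} A B {u v u' v'} → StrictInc u → StrictInc v → IsFPFWord z (A ++ u ++ v ++ B) →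
  fStep u v ≡ just (u' , v') → StrictInc u' × StrictInc v' × IsFPFWord z (A ++ u' ++ v' ++ B)
block-step A B {u} {v} inc-u inc-v fpf step with split-block A u v B (proj₁ fpf)
... | _ , pos-u , pos-v , _ with fStep-exchange inc-u inc-v pos-u pos-v (block-reduced A u v B fpf) step
...   | inc-u' , inc-v' , exchange = inc-u' , inc-v' , replace-block A B fpf exchange

lemma5p6 : (z : ℕ → ℕ) (m : ℕ) (ws : List (List ℕ)) (i : ℕ) →
    InF∞ z → InRF m z ws → 1 ≤ i → i < m →
    (ws' : List (List ℕ)) → fF i ws ≡ just ws' → InRF m z ws'
lemma5p6 z m ws i _ (length-ws , increasing , fpf) _ _ ws' eq with fF-acts-locally i ws ws' eq
... | acts-on pre u v post u' v' refl refl step with All.++⁻ pre increasing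
...   | inc-pre , inc-u ∷ inc-v ∷ inc-post
  with block-step (concat pre) (concat post) inc-u inc-v
         (subst (IsFPFWord z) (concat-blocks pre u v post) fpf) step
...     | inc-u' , inc-v' , fpf' =
  trans (length-++ pre {u' ∷ v' ∷ post}) (trans (sym (length-++ pre {u ∷ v ∷ post})) length-ws) ,
  All.++⁺ inc-pre (inc-u' ∷ inc-v' ∷ inc-post) ,
  subst (IsFPFWord z) (sym (concat-blocks pre u' v' post)) fpf'
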